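{- Let $R$ be a finite ring of order $v$ with unity, and let $U(R)$ be its group of units. If $U$ is a subgroup of $U(R)$ of order $k$ such that $u-1\in U(R)$ for each $u\in U\setminus\{1\}$, then there exists a Ferrero $(v,k,k-1)$-DDF in the additive group of $R$.
   Context: For a subset $B$ of an additive group $G$, $\Delta B$ is the multiset of all differences $b-b'$ of distinct $b,b'\in B$. A $(v,k,\lambda)$-DDF (disjoint difference family) in a group $G$ of order $v$ is a collection of pairwise disjoint $k$-subsets of $G$ whose lists of differences together cover every non-zero element of $G$ exactly $\lambda$ times. A Ferrero pair is a pair $(G,A)$ with $A$ a non-trivial group of automorphisms of $G$ such that $\alpha(g)=g$ for $\alpha\in A$, $g\in G$ only if $\alpha=\mathrm{id}$ or $g=0$. A Ferrero $(v,k,k-1)$-DDF is the set of $A$-orbits on $G\setminus\{0\}$ for a Ferrero pair $(G,A)$ with $|G|=v$, $|A|=k$ (this set is a $(v,k,k-1)$-DDF in $G$). -}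

module Defs where

open import Level using (_⊔_)
open import Data.Nat using (ℕ; _<_)
open import Data.Fin using (Fin)
open import Data.Product using (Σ; ∃; _×_)
open import Data.Sum using (_⊎_)
open import Relation.Nullary using (¬_)
open import Relation.Binary.PropositionalEquality as ≡ using (_≡_)
open import Function.Bundles using (Inverse)
open import Algebra.Bundles using (Group; Ring)

HasOrder : ∀ {c ℓ} (G : Group c ℓ) → ℕ → Set (c ⊔ ℓ)
HasOrder G v = Inverse (Group.setoid G) (≡.setoid (Fin v))

RingHasOrder : ∀ {c ℓ} (R : Ring c ℓ) → ℕ → Set (c ⊔ ℓ)
RingHasOrder R v = Inverse (Ring.setoid R) (≡.setoid (Fin v))

module _ {c ℓ} (G : Group c ℓ) where
  open Group G

  _≐_ : (Carrier → Carrier) → (Carrier → Carrier) → Set (c ⊔ ℓ)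
  f ≐ g = ∀ x → f x ≈ g x

  idMap : Carrier → Carrier
  idMap x = x

  _∘′_ : (Carrier → Carrier) → (Carrier → Carrier) → Carrier → Carrier
  (f ∘′ g) x = f (g x)

  IsAutomorphism : (Carrier → Carrier) → Set (c ⊔ ℓ)
  IsAutomorphism f =
    (∀ {x y} → x ≈ y → f x ≈ f y) ×
    (∀ x y → f (x ∙ y) ≈ (f x ∙ f y)) ×
    Σ (Carrier → Carrier) (λ g → (∀ x → g (f x) ≈ x) × (∀ x → f (g x) ≈ x))

  -- A subgroup of Aut(G) of order k, listed without repetition as aut : Fin k → Aut(G)
  record AutSubgroupOfOrder (k : ℕ) : Set (c ⊔ ℓ) where
    field
      aut      : Fin k → Carrier → Carrier
      isAut    : ∀ i → IsAutomorphism (aut i)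
      distinct : ∀ i j → aut i ≐ aut j → i ≡ j
      hasId    : ∃ λ i → aut i ≐ idMap
      closed   : ∀ i j → ∃ λ l → aut l ≐ (aut i ∘′ aut j)
      inverses : ∀ i → ∃ λ j → (aut j ∘′ aut i) ≐ idMap

  record FerreroPair (k : ℕ) : Set (c ⊔ ℓ) where
    field
      A          : AutSubgroupOfOrder k
    open AutSubgroupOfOrder A
    field
      nontrivial : ∃ λ i → ¬ (aut i ≐ idMap)
      fpf        : ∀ i g → aut i g ≈ g → (aut i ≐ idMap) ⊎ (g ≈ ε)

  -- A Ferrero (v,k,k-1)-DDF in G is the set of A-orbits on G∖{0} for a Ferrero
  -- pair (G,A) with |G| = v, |A| = k; its existence is the existence of such a pair.
  HasFerreroDDF : ℕ → ℕ → Set (c ⊔ ℓ)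
  HasFerreroDDF v k = HasOrder G v × FerreroPair k

module _ {c ℓ} (R : Ring c ℓ) where
  open Ring R

  IsUnit : Carrier → Set (c ⊔ ℓ)
  IsUnit x = Σ Carrier λ y → (x * y ≈ 1#) × (y * x ≈ 1#)

  -- A subgroup U of U(R) of order k, listed without repetition as u : Fin k → R
  record UnitSubgroupOfOrder (k : ℕ) : Set (c ⊔ ℓ) where
    field
      u        : Fin k → Carrier
      isUnit   : ∀ i → IsUnit (u i)
      distinct : ∀ i j → u i ≈ u j → i ≡ j
      hasOne   : ∃ λ i → u i ≈ 1#
      closed   : ∀ i j → ∃ λ l → u l ≈ (u i * u j)
      inverses : ∀ i → ∃ λ j → u j * u i ≈ 1#

module Submission where

-- Then U acts on the additive group (R, +) by
-- left multiplication, and this action is fixed-point-free: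
--   * left multiplication by a unit is an automorphism of (R, +), and
--     u ↦ (x ↦ u x) is injective (evaluate at 1), so the maps x ↦ u x form
--     a subgroup of Aut(R, +) of the same order as U;
--   * if u x = x then (u - 1) x = 0, and if moreover u ≠ 1 then u - 1 is a
--     unit, which cancels to give x = 0.
-- Non-triviality comes from |U| > 1.  Hence (R, U) is a Ferrero pair, whose
-- orbits on R ∖ {0} form the Ferrero (v, k, k-1)-DDF.

open import Defs
open import Data.Nat using (ℕ; _<_; s≤s; z≤n)
open import Data.Fin using (Fin; zero; punchIn)
open import Data.Fin.Properties using (_≟_; punchInᵢ≢i)
open import Data.Product using (∃; _,_; proj₁; proj₂)
open import Data.Sum using (_⊎_; inj₁; inj₂)
open import Relation.Nullary using (¬_; yes; no)
open import Relation.Binary.PropositionalEquality using (_≡_; _≢_; refl)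
open import Algebra.Bundles using (Ring)
import Relation.Binary.Reasoning.Setoid as SetoidReasoning

otherIndex : ∀ {n} → 1 < n → (i : Fin n) → ∃ λ j → j ≢ i
otherIndex (s≤s (s≤s z≤n)) i = punchIn i zero , punchInᵢ≢i i zero

module UnitAction {c ℓ} (R : Ring c ℓ) where
  open Ring R
  open SetoidReasoning setoid

  mult : Carrier → Carrier → Carrier
  mult a x = a * x

  mult-isAutomorphism : ∀ {a} → IsUnit R a → IsAutomorphism +-group (mult a)
  mult-isAutomorphism {a} (b , ab≈1 , ba≈1) =
    *-congˡ , distribˡ a , mult b , cancel b a ba≈1 , cancel a b ab≈1
    where
    cancel : ∀ s t → s * t ≈ 1# → ∀ x → s * (t * x) ≈ x
    cancel s t st≈1 x = begin
      s * (t * x) ≈⟨ sym (*-assoc s t x) ⟩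
      (s * t) * x ≈⟨ *-congʳ st≈1 ⟩
      1# * x      ≈⟨ *-identityˡ x ⟩
      x           ∎

  mult-≐⇒≈ : ∀ a b → _≐_ +-group (mult a) (mult b) → a ≈ b
  mult-≐⇒≈ a b h = begin
    a      ≈⟨ sym (*-identityʳ a) ⟩
    a * 1# ≈⟨ h 1# ⟩
    b * 1# ≈⟨ *-identityʳ b ⟩
    b      ∎

  mult-≈⇒≐ : ∀ {a b} → a ≈ b → _≐_ +-group (mult a) (mult b)
  mult-≈⇒≐ a≈b x = *-congʳ a≈b

  mult-one : _≐_ +-group (mult 1#) (idMap +-group)
  mult-one = *-identityˡ

  mult-≐id⇒≈1 : ∀ a → _≐_ +-group (mult a) (idMap +-group) → a ≈ 1#
  mult-≐id⇒≈1 a h = mult-≐⇒≈ a 1# λ x → trans (h x) (sym (mult-one x))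

  mult-≈1⇒≐id : ∀ {a} → a ≈ 1# → _≐_ +-group (mult a) (idMap +-group)
  mult-≈1⇒≐id a≈1 x = trans (mult-≈⇒≐ a≈1 x) (mult-one x)

  fixed⇒annihilated : ∀ u x → u * x ≈ x → (u + - 1#) * x ≈ 0#
  fixed⇒annihilated u x ux≈x = begin
    (u + - 1#) * x      ≈⟨ distribʳ x u (- 1#) ⟩
    u * x + - 1# * x    ≈⟨ +-congʳ (trans ux≈x (sym (*-identityˡ x))) ⟩
    1# * x + - 1# * x   ≈⟨ sym (distribʳ x 1# (- 1#)) ⟩
    (1# + - 1#) * x     ≈⟨ *-congʳ (-‿inverseʳ 1#) ⟩
    0# * x              ≈⟨ zeroˡ x ⟩
    0#                  ∎

  unit-annihilates⇒zero : ∀ {a} x → IsUnit R a → a * x ≈ 0# → x ≈ 0#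
  unit-annihilates⇒zero {a} x (b , _ , ba≈1) ax≈0 = begin
    x            ≈⟨ sym (*-identityˡ x) ⟩
    1# * x       ≈⟨ *-congʳ (sym ba≈1) ⟩
    (b * a) * x  ≈⟨ *-assoc b a x ⟩
    b * (a * x)  ≈⟨ *-congˡ ax≈0 ⟩
    b * 0#       ≈⟨ zeroʳ b ⟩
    0#           ∎

  fixed⇒zero : ∀ u x → IsUnit R (u + - 1#) → u * x ≈ x → x ≈ 0#
  fixed⇒zero u x unit ux≈x =
    unit-annihilates⇒zero x unit (fixed⇒annihilated u x ux≈x)

  module _ {k} (U : UnitSubgroupOfOrder R k) where
    open UnitSubgroupOfOrder U

    multSubgroup : AutSubgroupOfOrder +-group k
    multSubgroup = record
      { aut      = λ i → mult (u i)
      ; isAut    = λ i → mult-isAutomorphism (isUnit i)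
      ; distinct = λ i j h → distinct i j (mult-≐⇒≈ (u i) (u j) h)
      ; hasId    = proj₁ hasOne , mult-≈1⇒≐id (proj₂ hasOne)
      ; closed   = λ i j → proj₁ (closed i j) , λ x →
                     trans (mult-≈⇒≐ (proj₂ (closed i j)) x) (*-assoc (u i) (u j) x)
      ; inverses = λ i → proj₁ (inverses i) , λ x →
                     let j = proj₁ (inverses i) in
                     trans (sym (*-assoc (u j) (u i) x))
                           (mult-≈1⇒≐id (proj₂ (inverses i)) x)
      }

    multFerreroPair : 1 < k →
      (∀ i → ¬ (u i ≈ 1#) → IsUnit R (u i + - 1#)) →
      FerreroPair +-group k
    multFerreroPair 1<k unitDiff = record
      { A          = multSubgroup
      ; nontrivial = j , λ h → j≢one (≈1⇒one j (mult-≐id⇒≈1 (u j) h))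
      ; fpf        = fixedPointFree
      }
      where
      one : Fin k
      one = proj₁ hasOne

      u-one≈1 : u one ≈ 1#
      u-one≈1 = proj₂ hasOne

      ≈1⇒one : ∀ i → u i ≈ 1# → i ≡ one
      ≈1⇒one i e = distinct i one (trans e (sym u-one≈1))

      j : Fin k
      j = proj₁ (otherIndex 1<k one)

      j≢one : j ≢ one
      j≢one = proj₂ (otherIndex 1<k one)

      fixedPointFree : ∀ i x → u i * x ≈ x →
        _≐_ +-group (mult (u i)) (idMap +-group) ⊎ (x ≈ 0#)
      fixedPointFree i x ux≈x with i ≟ one
      ... | yes refl = inj₁ (mult-≈1⇒≐id u-one≈1)
      ... | no i≢one =
        inj₂ (fixed⇒zero (u i) x (unitDiff i (λ e → i≢one (≈1⇒one i e))) ux≈x)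

lemma1 : ∀ {c ℓ} (R : Ring c ℓ) (v k : ℕ) → RingHasOrder R v →
         (U : UnitSubgroupOfOrder R k) →
         1 < k →
         (∀ i → ¬ (Ring._≈_ R (UnitSubgroupOfOrder.u U i) (Ring.1# R)) →
            IsUnit R (Ring._+_ R (UnitSubgroupOfOrder.u U i) (Ring.-_ R (Ring.1# R)))) →
         HasFerreroDDF (Ring.+-group R) v k
lemma1 R v k order U 1<k unitDiff =
  order , UnitAction.multFerreroPair R U 1<k unitDiff
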